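{- Assume the setting and Assumption $(\Omega)$ described in the context. Let $Q_{x_1,y_1}$ and $Q_{x_2,y_2}$ be two distinct overload-discharge quadruples in $\mathcal{Q}$, associated with $x_1,y_1$ and with $x_2,y_2$ respectively ($x_1,y_1,x_2,y_2 \in V(C_T)$). If $\rho(y_1) = \rho(y_2) =: l$, then $V(\rho([x_1,y_1])) \cap V(\rho([x_2,y_2])) = \{l\}$ and $l$ is a vertex of the support subtree $T^*$.
   Context: $\mathbb{N} = \{1,2,\dots\}$. $T$ is a finite tree with vertex weights $c : V(T) \to \mathbb{N}$; for a subgraph $H$, $c(H) := \sum_{v \in V(H)} c(v)$. $k, g \in \mathbb{N}$ with $1 \leq k \leq N_2 := c(T)$ and $c(v) \leq k$ for all $v \in V(T)$. Euler tour: fix a planar embedding of $T$. For each $v$, list incident edges clockwise as $e_{v,1},\dots,e_{v,d_T(v)}$. The directed cycle $C_T$ has vertices $w_{v,i}$ ($1 \le i \le d_T(v)$, indices modulo $d_T(v)$) and, for every edge $uv = e_{u,i} = e_{v,j}$, arcs $w_{u,i} \to w_{v,j+1}$ and $w_{v,j} \to w_{u,i+1}$. For $x$ on $C_T$, $x^+$, $x^-$ are successor and predecessor; $[x,y]$ is the directed path from $x$ to $y$ along $C_T$. $\rho(w_{v,i}) := v$, $\rho([x,y])$ is the subtree of $T$ induced by $\{\rho(z): z \in V([x,y])\}$, $c([x,y]) := c(\rho([x,y]))$. Assumption $(\Omega)$: there are no $x, y \in V(C_T)$ with $k - g + 1 \leq c([x,y]) \leq k$. If $u, v \in V(C_T)$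 satisfy $c([u, v^-]) < k - g + 1$ and $c([u,v]) > k$, let $w$ be the vertex of $[u, v^-]$ with $c([w,v]) > k$ and $c([w^+, v]) < k - g + 1$; $Q_{u,v} := (\rho([u,v]), \rho(v), V(\rho([u,v])) \setminus V(\rho([w,v])), \rho(w))$, maximal if also $c([u^-, v^-]) > k$. $\mathcal{Q}$ is the set of maximal quadruples. Support subtree: for a root $a$, $T^{(a)}_v$ is the subtree consisting of $v$ and its descendants. Fix a vertex $a$ and a vertex $r$ with $c(T^{(a)}_r) > k$ and $c(T^{(a)}_w) \leq k$ for every child $w$ of $r$ in $T$ rooted at $a$. Then let $r_1,\dots,r_t$ be all vertices with $c(T^{(r)}_{r_i}) > k$ and $c(T^{(r)}_w) \leq k$ for every child $w$ of $r_i$ in $T$ rooted at $r$. The support vertices are $r, r_1, \dots, r_t$, and the support subtree $T^*$ is the minimal subtree of $T$ containing all support vertices (fixed once and for all). -}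

module Defs where

open import Data.Nat using (ℕ; zero; suc; _+_; _*_; _≤_; _<_)
open import Data.Bool using (Bool; true; false; if_then_else_)
open import Data.Fin using (Fin) renaming (_≟_ to _≟F_)
open import Data.Fin.Subset using (Subset; _─_) renaming (_∈_ to _∈ₛ_)
open import Data.List using (List; []; _∷_; _∷ʳ_; reverse; length)
open import Data.Bool.ListAction using (any)
open import Data.List.Membership.Propositional using (_∈_)
open import Data.List.Relation.Unary.All using (All)
open import Data.List.Relation.Unary.Unique.Propositional using (Unique)
open import Data.Vec as Vec using (tabulate)
open import Data.Product using (Σ; ∃; ∃-syntax; _×_; _,_; proj₁; proj₂)
open import Data.Sum using (_⊎_)
open import Relation.Nullary using (¬_; does)
open import Relation.Binary.PropositionalEquality using (_≡_)
open import Function.Bundles using (_⇔_)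

-- A plane tree on the vertex set Fin n.
-- rot v = the neighbours of v listed clockwise, i.e. rot v lists the
-- other endpoints of e_{v,1}, …, e_{v,d(v)} in this order.
-- (A rotation system: the combinatorial form of a planar embedding.)

Rot : ℕ → Set
Rot n = Fin n → List (Fin n)

module _ {n : ℕ} (rot : Rot n) where

  Adj : Fin n → Fin n → Set
  Adj u v = v ∈ rot u

  data Chain : List (Fin n) → Set where
    []  : Chain []
    [-] : ∀ x → Chain (x ∷ [])
    _∷_ : ∀ {x y l} → Adj x y → Chain (y ∷ l) → Chain (x ∷ y ∷ l)

  WalkFromTo : Fin n → Fin n → List (Fin n) → Set
  WalkFromTo u v l = Chain l × (∃[ m ] l ≡ u ∷ m) × (∃[ p ] l ≡ p ∷ʳ v)

  PathFromTo : Fin n → Fin n → List (Fin n) → Set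
  PathFromTo u v l = WalkFromTo u v l × Unique l

  HasCycle : Set
  HasCycle = ∃[ x ] ∃[ xs ] ∃[ y ]
    (Unique ((x ∷ xs) ∷ʳ y) × 1 ≤ length xs × Chain ((x ∷ xs) ∷ʳ y) × Adj y x)

  record IsPlaneTree : Set where
    field
      rot-unique : ∀ v → Unique (rot v)
      rot-irrefl : ∀ v → ¬ (v ∈ rot v)
      rot-sym    : ∀ u v → v ∈ rot u → u ∈ rot v
      connected  : ∀ u v → ∃[ l ] WalkFromTo u v l
      acyclic    : ¬ HasCycle

  -- The Euler tour C_T.
  -- The vertex w_{u,i} of C_T, where e_{u,i} = uv, is represented by the
  -- dart (u , v).  ρ(u , v) = u.

  Dart : Set
  Dart = Fin n × Fin n

  IsDart : Dart → Set
  IsDart (u , v) = Adj u v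

  ρ : Dart → Fin n
  ρ = proj₁

  _==_ : Fin n → Fin n → Bool
  x == y = does (x ≟F y)

  -- cyclic successor of u in a list (u itself if u is absent)
  afterGo : Fin n → Fin n → List (Fin n) → Fin n
  afterGo u first []            = u
  afterGo u first (x ∷ [])      = if x == u then first else u
  afterGo u first (x ∷ y ∷ l)   = if x == u then y else afterGo u first (y ∷ l)

  after : Fin n → List (Fin n) → Fin n
  after u []      = u
  after u (x ∷ l) = afterGo u x (x ∷ l)

  before : Fin n → List (Fin n) → Fin n
  before u l = after u (reverse l)

  -- w_{u,i} ↦ w_{v,j+1}  where e_{u,i} = uv = e_{v,j}
  succ⁺ : Dart → Dart
  succ⁺ (u , v) = (v , after u (rot v))

  pred⁻ : Dart → Dart
  pred⁻ (v , w) = (before w (rot v) , v)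

  _==D_ : Dart → Dart → Bool
  (a , b) ==D (c , d) = if a == c then b == d else false

  -- the directed path [x , y] along C_T as a list of darts, by iterating
  -- the successor from x until y is reached (fuel n*n ≥ |V(C_T)|)
  pathFuel : ℕ → Dart → Dart → List Dart
  pathFuel zero    x y = x ∷ []
  pathFuel (suc f) x y = if x ==D y then x ∷ [] else x ∷ pathFuel f (succ⁺ x) y

  seg : Dart → Dart → List Dart
  seg x y = pathFuel (n * n) x y

  segV : Dart → Dart → Subset n
  segV x y = tabulate (λ v → any (λ z → ρ z == v) (seg x y))

  Desc : Fin n → Fin n → Fin n → Set
  Desc a v u = ∃[ l ] (PathFromTo a u l × v ∈ l)

  Child : Fin n → Fin n → Fin n → Set
  Child a v w = Adj v w × Desc a v w

  IsDescSet : Fin n → Fin n → Subset n → Set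
  IsDescSet a v S = ∀ u → (u ∈ₛ S) ⇔ Desc a v u

  ConnectedSet : Subset n → Set
  ConnectedSet S = ∀ u v → u ∈ₛ S → v ∈ₛ S →
    ∃[ l ] (WalkFromTo u v l × All (_∈ₛ S) l)

wt : {n : ℕ} → (Fin n → ℕ) → Subset n → ℕ
wt c S = Vec.sum (Vec.zipWith (λ b x → if b then x else 0) S (tabulate c))

module _ {n : ℕ} (rot : Rot n) (c : Fin n → ℕ) (k g : ℕ) where

  cseg : Dart rot → Dart rot → ℕ
  cseg x y = wt c (segV rot x y)

  -- Assumption (Ω): no x, y with k - g + 1 ≤ c([x,y]) ≤ k
  -- (k - g + 1 ≤ m is written  k < m + g  to avoid truncated subtraction)
  Omega : Set
  Omega = ∀ x y → IsDart rot x → IsDart rot y →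
    ¬ (k < cseg x y + g × cseg x y ≤ k)

  -- the data (u , v , w) defining Q_{u,v}
  -- (c < k - g + 1 is written  c + g ≤ k)
  QuadData : Dart rot → Dart rot → Dart rot → Set
  QuadData u v w =
      IsDart rot u × IsDart rot v × IsDart rot w
    × cseg u (pred⁻ rot v) + g ≤ k
    × k < cseg u v
    × w ∈ seg rot u (pred⁻ rot v)
    × k < cseg w v
    × cseg (succ⁺ rot w) v + g ≤ k

  MaxQuadData : Dart rot → Dart rot → Dart rot → Set
  MaxQuadData u v w = QuadData u v w × k < cseg (pred⁻ rot u) (pred⁻ rot v)

  Quad : Set
  Quad = Subset n × Fin n × Subset n × Fin n

  -- Q_{u,v} = (ρ([u,v]), ρ(v), V(ρ([u,v])) ∖ V(ρ([w,v])), ρ(w))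
  -- (the subtree ρ([u,v]) is induced, so it is given by its vertex set)
  quad : Dart rot → Dart rot → Dart rot → Quad
  quad u v w = (segV rot u v , ρ rot v , segV rot u v ─ segV rot w v , ρ rot w)

  Heavy : Fin n → Fin n → Set
  Heavy a v = ∀ S → IsDescSet rot a v S → k < wt c S

  Light : Fin n → Fin n → Set
  Light a v = ∀ S → IsDescSet rot a v S → wt c S ≤ k

  -- condition on r (w.r.t. root a), and on the r_i (w.r.t. root r)
  LowestHeavy : Fin n → Fin n → Set
  LowestHeavy a v = Heavy a v × (∀ w → Child rot a v w → Light a w)

  IsSupport : Fin n → Fin n → Set
  IsSupport r v = v ≡ r ⊎ LowestHeavy r v

  -- l is a vertex of T*, the minimal subtree containing all support
  -- vertices (= the intersection of all subtrees containing them)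
  InSupportTree : Fin n → Fin n → Set
  InSupportTree r l = ∀ S → ConnectedSet rot S →
    (∀ v → IsSupport r v → v ∈ₛ S) → l ∈ₛ S

module Submission where

-- Write l = ρ(y) and t = ρ(y⁻) for a maximal quadruple Q_{x,y}. Since c([x,y⁻]) < c([x,y]),
-- the tour from x reaches y⁻ and then y without visiting l before, so every vertex of
-- ρ([x,y]) other than l is joined to the neighbour t of l by a walk avoiding l. Maximality
-- and the conditions on w determine x and w from y (a later start would put the heavy
-- [x⁻,y⁻] inside a light segment), so two distinct quadruples with the same l have distinct
-- tails t₁ ≠ t₂, and a second common vertex would join t₁ and t₂ around l, closing a cycle.
-- Rooting T at r: if l is not on the path from r to tᵢ, that path avoids l, and this cannot
-- happen for both i. Otherwise l is an ancestor of all of ρ([xᵢ⁻,yᵢ⁻]), so T^{(r)}_l is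
-- heavy, hence contains a lowest heavy vertex, i.e. a support vertex below l, and l lies on T*.

open import Defs
open import Data.Bool using (Bool; true; false; T; if_then_else_)
open import Data.Bool.ListAction using (any)
open import Data.Bool.Properties using (T-≡)
open import Data.Empty using (⊥; ⊥-elim)
open import Data.Fin using (Fin; zero; suc) renaming (_≟_ to _≟ᶠ_)
open import Data.Fin.Subset using (Subset; inside; outside; _∩_; ⁅_⁆; ⊤)
  renaming (_∈_ to _∈ₛ_; _∉_ to _∉ₛ_; _⊆_ to _⊆ₛ_)
open import Data.Fin.Subset.Properties
  using (drop-∷-⊆; ⊆-antisym; p∩q⊆p; p∩q⊆q; x∈p∩q⁺; x∈⁅x⁆; x∈⁅y⁆⇒x≡y)
open import Data.List using (List; []; _∷_; _∷ʳ_; _++_; _ʳ++_; reverse; map)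
open import Data.List.Membership.Propositional using (_∈_; _∉_; find; lose)
open import Data.List.Membership.Propositional.Properties
  using (∈-∃++; ∈-++⁺ˡ; ∈-++⁺ʳ; ∈-++⁻; ∈-map⁺; ∈-map⁻)
open import Data.List.Properties
  using (∷-injective; reverse-++; unfold-reverse; reverse-involutive; ʳ++-defn; ++-assoc)
open import Data.List.Relation.Binary.Subset.Propositional using (_⊆_)
open import Data.List.Relation.Binary.Subset.Propositional.Properties using (∷⁺ʳ; ++⁺ʳ; ⊆-reflexive; map⁺)
open import Data.List.Relation.Unary.All using ([]; _∷_)
import Data.List.Relation.Unary.All as All
open import Data.List.Relation.Unary.All.Properties using (All¬⇒¬Any)
open import Data.List.Relation.Unary.All.Properties.Core using (¬Any⇒All¬)
import Data.List.Relation.Unary.AllPairs as AllPairs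
open import Data.List.Relation.Unary.Any using (here; there; any?)
import Data.List.Relation.Unary.Any.Properties as Any
open import Data.List.Relation.Unary.Unique.Propositional using (Unique)
import Data.List.Relation.Unary.Unique.Propositional.Properties as Unique
open import Data.Nat using (ℕ; zero; suc; _+_; _*_; _≤_; _<_; z≤n; s≤s)
open import Data.Nat.Induction using (<-wellFounded)
open import Data.Nat.Properties
  using (≤-refl; ≤-trans; <-≤-trans; ≤-<-trans; <-cmp; <⇒≱; <⇒≤; ≤-pred; ≮⇒≥; _<?_;
         m≤m+n; m≤n+m; m≤n⇒m≤1+n; m≤n⇒m<n∨m≡n; m≤n⇒∃[o]m+o≡n; +-comm; +-assoc;
         +-mono-≤; +-mono-<-≤; +-mono-≤-<; +-monoʳ-≤; +-monoʳ-<)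
open import Data.Product using (∃-syntax; _×_; _,_; proj₁; proj₂)
open import Data.Product.Properties using (≡-dec)
open import Data.Sum using (_⊎_; inj₁; inj₂)
open import Data.Unit using (tt)
open import Data.Vec using (_∷_; tabulate)
import Data.Vec as Vec
open import Data.Vec.Properties using ([]=⇒lookup; lookup⇒[]=; lookup∘tabulate)
open import Function using (_∘_; id)
open import Function.Bundles using (_⇔_; mk⇔; Equivalence)
open import Function.Properties.Equivalence using () renaming (trans to ⇔-trans)
open import Induction.WellFounded using (Acc; acc)
open import Relation.Binary.Definitions using (DecidableEquality; tri<; tri≈; tri>)
open import Relation.Binary.PropositionalEquality
  using (_≡_; _≢_; refl; sym; trans; cong; cong₂; subst; subst₂; module ≡-Reasoning)
open import Relation.Nullary using (¬_; yes; no; Dec)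
open import Relation.Nullary.Decidable using (⌊_⌋; map′; _×-dec_; toWitness; fromWitness)

-- Cyclic successor and predecessor in a duplicate-free list
module _ {A : Set} where

  Unique-head : ∀ {x : A} {xs} → Unique (x ∷ xs) → x ∉ xs
  Unique-head u = All¬⇒¬Any (AllPairs.head u)

  Unique-dropˡ : ∀ (xs : List A) {ys} → Unique (xs ++ ys) → Unique ys
  Unique-dropˡ []       u = u
  Unique-dropˡ (_ ∷ xs) u = Unique-dropˡ xs (AllPairs.tail u)

  Unique-∉-prefix : ∀ (xs : List A) {y ys} → Unique (xs ++ y ∷ ys) → y ∉ xs
  Unique-∉-prefix (x ∷ xs) u (here refl) = Unique-head u (∈-++⁺ʳ xs (here refl))
  Unique-∉-prefix (x ∷ xs) u (there y∈) = Unique-∉-prefix xs (AllPairs.tail u) y∈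

  Unique-disjoint : ∀ (xs : List A) {ys x} → Unique (xs ++ ys) → x ∈ xs → x ∈ ys → ⊥
  Unique-disjoint (_ ∷ xs) u (here refl) x∈ys = Unique-head u (∈-++⁺ʳ xs x∈ys)
  Unique-disjoint (_ ∷ xs) u (there x∈xs) x∈ys = Unique-disjoint xs (AllPairs.tail u) x∈xs x∈ys

  Unique-reverse : ∀ {xs : List A} → Unique xs → Unique (reverse xs)
  Unique-reverse {[]}     u = u
  Unique-reverse {x ∷ xs} u = subst Unique (sym (unfold-reverse x xs))
    (Unique.++⁺ (Unique-reverse (AllPairs.tail u)) ([] AllPairs.∷ AllPairs.[])
      λ { (x∈ , here refl) → Unique-head u (Any.reverse⁻ x∈) })

module _ {n : ℕ} (rot : Rot n) where

  private
    V = Fin n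

    head-≢ : ∀ {u a : V} {xs} → u ∉ a ∷ xs → a ≢ u
    head-≢ u∉ refl = u∉ (here refl)

    if-≡ : ∀ {B : Set} {u : V} {z w : B} → (if _==_ rot u u then z else w) ≡ z
    if-≡ {u = u} with u ≟ᶠ u
    ... | yes _  = refl
    ... | no u≢u = ⊥-elim (u≢u refl)

    if-≢ : ∀ {B : Set} {a u : V} {z w : B} → a ≢ u → (if _==_ rot a u then z else w) ≡ w
    if-≢ {a = a} {u} a≢u with a ≟ᶠ u
    ... | yes a≡u = ⊥-elim (a≢u a≡u)
    ... | no _    = refl

    afterGo-split : ∀ {u y : V} f pre post → u ∉ pre → afterGo rot u f (pre ++ u ∷ y ∷ post) ≡ y
    afterGo-split {u} f []       post _  = if-≡ {u = u}
    afterGo-split {u} f (a ∷ []) post u∉ = trans (if-≢ (head-≢ u∉)) (afterGo-split {u} f [] post (λ ()))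
    afterGo-split f (a ∷ b ∷ pre) post u∉ =
      trans (if-≢ (head-≢ u∉)) (afterGo-split f (b ∷ pre) post (u∉ ∘ there))

    afterGo-wrap : ∀ {u : V} f pre → u ∉ pre → afterGo rot u f (pre ∷ʳ u) ≡ f
    afterGo-wrap {u} f []       _  = if-≡ {u = u}
    afterGo-wrap {u} f (a ∷ []) u∉ = trans (if-≢ (head-≢ u∉)) (afterGo-wrap {u} f [] (λ ()))
    afterGo-wrap f (a ∷ b ∷ pre) u∉ =
      trans (if-≢ (head-≢ u∉)) (afterGo-wrap f (b ∷ pre) (u∉ ∘ there))

  after-split : ∀ {u y : V} pre post → u ∉ pre → after rot u (pre ++ u ∷ y ∷ post) ≡ y
  after-split []      post = afterGo-split _ [] post
  after-split (_ ∷ _) post = afterGo-split _ (_ ∷ _) post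

  after-wrap : ∀ {u x : V} pre → u ∉ x ∷ pre → after rot u ((x ∷ pre) ∷ʳ u) ≡ x
  after-wrap pre = afterGo-wrap _ (_ ∷ pre)

  after-∈×before-after : ∀ {u : V} {l} → Unique l → u ∈ l →
    after rot u l ∈ l × before rot (after rot u l) l ≡ u
  after-∈×before-after {u} U u∈ with ∈-∃++ u∈
  ... | pre , y ∷ post , refl =
      subst (_∈ pre ++ u ∷ y ∷ post) (sym u↦y) (∈-++⁺ʳ pre (there (here refl)))
    , (begin
        before rot (after rot u (pre ++ u ∷ y ∷ post)) (pre ++ u ∷ y ∷ post)
          ≡⟨ cong (λ z → after rot z (reverse (pre ++ u ∷ y ∷ post))) u↦y ⟩
        after rot y (reverse (pre ++ u ∷ y ∷ post))
          ≡⟨ cong (after rot y) reverse-l ⟩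
        after rot y (reverse post ++ y ∷ u ∷ reverse pre)
          ≡⟨ after-split (reverse post) (reverse pre) (Unique-head y∷post-unique ∘ Any.reverse⁻) ⟩
        u ∎)
    where
    open ≡-Reasoning
    u↦y : after rot u (pre ++ u ∷ y ∷ post) ≡ y
    u↦y = after-split pre post (Unique-∉-prefix pre U)
    y∷post-unique : Unique (y ∷ post)
    y∷post-unique = AllPairs.tail (Unique-dropˡ pre U)
    reverse-l : reverse (pre ++ u ∷ y ∷ post) ≡ reverse post ++ y ∷ u ∷ reverse pre
    reverse-l = begin
      reverse (pre ++ u ∷ y ∷ post)               ≡⟨ reverse-++ pre (u ∷ y ∷ post) ⟩
      (post ʳ++ (y ∷ u ∷ [])) ++ reverse pre      ≡⟨ cong (_++ reverse pre) (ʳ++-defn post) ⟩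
      (reverse post ++ y ∷ u ∷ []) ++ reverse pre ≡⟨ ++-assoc (reverse post) (y ∷ u ∷ []) (reverse pre) ⟩
      reverse post ++ y ∷ u ∷ reverse pre         ∎
  ... | [] , [] , refl rewrite if-≡ {u = u} {z = u} {w = u} = here refl , if-≡ {u = u}
  ... | x ∷ pre , [] , refl =
      subst (_∈ (x ∷ pre) ∷ʳ u) (sym u↦x) (here refl)
    , (begin
        before rot (after rot u ((x ∷ pre) ∷ʳ u)) ((x ∷ pre) ∷ʳ u)
          ≡⟨ cong (λ z → after rot z (reverse ((x ∷ pre) ∷ʳ u))) u↦x ⟩
        after rot x (reverse ((x ∷ pre) ∷ʳ u))   ≡⟨ cong (after rot x) reverse-l ⟩
        after rot x ((u ∷ reverse pre) ∷ʳ x)     ≡⟨ after-wrap (reverse pre) x∉ ⟩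
        u                                        ∎)
    where
    open ≡-Reasoning
    u↦x : after rot u ((x ∷ pre) ∷ʳ u) ≡ x
    u↦x = after-wrap pre (Unique-∉-prefix (x ∷ pre) U)
    reverse-l : reverse ((x ∷ pre) ∷ʳ u) ≡ (u ∷ reverse pre) ∷ʳ x
    reverse-l = trans (reverse-++ (x ∷ pre) (u ∷ [])) (cong (u ∷_) (ʳ++-defn pre))
    x∉ : x ∉ u ∷ reverse pre
    x∉ (here refl) = Unique-∉-prefix (x ∷ pre) U (here refl)
    x∉ (there x∈)  = Unique-head U (∈-++⁺ˡ {ys = u ∷ []} (Any.reverse⁻ x∈))

  after-∈ : ∀ {u : V} {l} → Unique l → u ∈ l → after rot u l ∈ l
  after-∈ U u∈ = proj₁ (after-∈×before-after U u∈)

  before-after : ∀ {u : V} {l} → Unique l → u ∈ l → before rot (after rot u l) l ≡ u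
  before-after U u∈ = proj₂ (after-∈×before-after U u∈)

  before-∈ : ∀ {u : V} {l} → Unique l → u ∈ l → before rot u l ∈ l
  before-∈ U u∈ = Any.reverse⁻ (after-∈ (Unique-reverse U) (Any.reverse⁺ u∈))

  after-before : ∀ {u : V} {l} → Unique l → u ∈ l → after rot (before rot u l) l ≡ u
  after-before {u} {l} U u∈ =
    subst (λ l′ → after rot (before rot u l) l′ ≡ u) (reverse-involutive l)
      (before-after (Unique-reverse U) (Any.reverse⁺ u∈))

∈-tabulate : ∀ {n} {f : Fin n → Bool} {x} → x ∈ₛ tabulate f ⇔ T (f x)
∈-tabulate {f = f} {x} = mk⇔
  (λ x∈ → Equivalence.from T-≡ (trans (sym (lookup∘tabulate f x)) ([]=⇒lookup x∈)))
  (λ fx → lookup⇒[]= x _ (trans (lookup∘tabulate f x) (Equivalence.to T-≡ fx)))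

private
  head-wt-≤ : ∀ {n} (c : Fin (suc n) → ℕ) {x y} {p q : Subset n} → x ∷ p ⊆ₛ y ∷ q →
    (if x then c zero else 0) ≤ (if y then c zero else 0)
  head-wt-≤ c {outside}                  _   = z≤n
  head-wt-≤ c {inside} {inside}          _   = ≤-refl
  head-wt-≤ c {inside} {outside} {p = p} p⊆q with p⊆q (Vec.here {xs = p})
  ... | ()

wt-mono : ∀ {n} (c : Fin n → ℕ) {p q : Subset n} → p ⊆ₛ q → wt c p ≤ wt c q
wt-mono {zero}  c {Vec.[]} {Vec.[]} _ = z≤n
wt-mono {suc n} c {_ ∷ _}  {_ ∷ _}  p⊆q = +-mono-≤ (head-wt-≤ c p⊆q) (wt-mono (c ∘ suc) (drop-∷-⊆ p⊆q))

wt-< : ∀ {n} (c : Fin n → ℕ) {p q : Subset n} {v} →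
  p ⊆ₛ q → v ∈ₛ q → v ∉ₛ p → 1 ≤ c v → wt c p < wt c q
wt-< c {outside ∷ _} {_ ∷ _} p⊆q Vec.here _ cv =
  +-mono-<-≤ cv (wt-mono (c ∘ suc) (drop-∷-⊆ p⊆q))
wt-< c {inside ∷ _} {_ ∷ _} _ Vec.here v∉p _ = ⊥-elim (v∉p Vec.here)
wt-< c {_ ∷ _} {_ ∷ _} p⊆q (Vec.there v∈q) v∉p cv =
  +-mono-≤-< (head-wt-≤ c p⊆q) (wt-< (c ∘ suc) (drop-∷-⊆ p⊆q) v∈q (v∉p ∘ Vec.there) cv)

-- Walks and paths in a tree

module _ {n : ℕ} (rot : Rot n) where

  data Walk : Fin n → Fin n → List (Fin n) → Set where
    [_] : ∀ x → Walk x x (x ∷ [])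
    _∷_ : ∀ {x y z l} → Adj rot x y → Walk y z l → Walk x z (x ∷ l)

module _ {n : ℕ} {rot : Rot n} where

  open import Data.List.Membership.DecPropositional (_≟ᶠ_ {n}) using (_∈?_)

  walk-head : ∀ {u v l} → Walk rot u v l → u ∈ l
  walk-head [ _ ]   = here refl
  walk-head (_ ∷ _) = here refl

  walk-last : ∀ {u v l} → Walk rot u v l → v ∈ l
  walk-last [ _ ]   = here refl
  walk-last (_ ∷ p) = there (walk-last p)

  walk-init : ∀ {u v l} → Walk rot u v l → ∃[ p ] l ≡ p ∷ʳ v
  walk-init [ _ ] = [] , refl
  walk-init (_ ∷ p) with walk-init p
  ... | xs , refl = _ ∷ xs , refl

  walk-chain : ∀ {u v l} → Walk rot u v l → Chain rot l
  walk-chain [ x ]           = [-] x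
  walk-chain (a ∷ [ y ])     = a ∷ [-] y
  walk-chain (a ∷ (b ∷ p))   = a ∷ walk-chain (b ∷ p)

  walk-++ : ∀ {u v w l₁ l₂} → Walk rot u v l₁ → Walk rot v w l₂ →
    ∃[ l ] Walk rot u w l × l ⊆ l₁ ++ l₂
  walk-++ [ _ ]   q = _ , q , ∈-++⁺ʳ _
  walk-++ (a ∷ p) q with walk-++ p q
  ... | _ , pq , pq⊆ = _ , a ∷ pq , ∷⁺ʳ _ pq⊆

  walk-split : ∀ {u v m l} → Walk rot u v l → m ∈ l → ∃[ pre ] ∃[ suf ]
    l ≡ pre ++ m ∷ suf × Walk rot u m (pre ∷ʳ m) × Walk rot m v (m ∷ suf)
  walk-split [ x ]   (here refl)  = [] , [] , refl , [ x ] , [ x ]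
  walk-split (a ∷ p) (here refl)  = [] , _ , refl , [ _ ] , a ∷ p
  walk-split (a ∷ p) (there m∈) with walk-split p m∈
  ... | pre , suf , refl , p₁ , p₂ = _ ∷ pre , suf , refl , a ∷ p₁ , p₂

  walk-toPath : ∀ {u v l} → Walk rot u v l → ∃[ l′ ] Walk rot u v l′ × Unique l′ × l′ ⊆ l
  walk-toPath [ x ] = _ , [ x ] , [] AllPairs.∷ AllPairs.[] , id
  walk-toPath {u} (a ∷ p) with walk-toPath p
  ... | l′ , q , U , l′⊆ with u ∈? l′
  ...   | no u∉ = _ , a ∷ q , ¬Any⇒All¬ _ u∉ AllPairs.∷ U , ∷⁺ʳ u l′⊆
  ...   | yes u∈ with walk-split q u∈
  ...     | pre , suf , refl , _ , q₂ =
                _ , q₂ , Unique-dropˡ pre U , there ∘ l′⊆ ∘ ∈-++⁺ʳ pre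

  walk-fromWalkFromTo : ∀ {u v l} → WalkFromTo rot u v l → Walk rot u v l
  walk-fromWalkFromTo (ch , (_ , refl) , (p , l≡)) = go ch p l≡
    where
    go : ∀ {u v l} → Chain rot (u ∷ l) → ∀ p → u ∷ l ≡ p ∷ʳ v → Walk rot u v (u ∷ l)
    go ([-] x)  []          refl = [ x ]
    go ([-] x)  (_ ∷ _ ∷ _) ()
    go (a ∷ ch) []          ()
    go (a ∷ ch) (_ ∷ p)     l≡   = a ∷ go ch p (proj₂ (∷-injective l≡))

  walk-toWalkFromTo : ∀ {u v l} → Walk rot u v l → WalkFromTo rot u v l
  walk-toWalkFromTo [ x ]     = [-] x , (_ , refl) , ([] , refl)
  walk-toWalkFromTo p@(_ ∷ _) = walk-chain p , (_ , refl) , walk-init p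

  walk-∷ʳ : ∀ {u v w l} → Walk rot u v l → Adj rot v w → Walk rot u w (l ∷ʳ w)
  walk-∷ʳ [ _ ]   a = a ∷ [ _ ]
  walk-∷ʳ (b ∷ p) a = b ∷ walk-∷ʳ p a

module _ {n : ℕ} {rot : Rot n} (PT : IsPlaneTree rot) where

  open IsPlaneTree PT
  open import Data.List.Membership.DecPropositional (_≟ᶠ_ {n}) using (_∈?_)

  private
    V = Fin n

  Adj-sym : ∀ {u v} → Adj rot u v → Adj rot v u
  Adj-sym = rot-sym _ _

  walk-reverse : ∀ {u v l} → Walk rot u v l → Walk rot v u (reverse l)
  walk-reverse [ x ]   = [ x ]
  walk-reverse {u} (_∷_ {l = l} a p) =
    subst (Walk rot _ _) (sym (unfold-reverse u l)) (walk-∷ʳ (walk-reverse p) (Adj-sym a))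

  path : ∀ u v → ∃[ l ] Walk rot u v l × Unique l
  path u v with walk-toPath (walk-fromWalkFromTo (proj₂ (connected u v)))
  ... | l , p , U , _ = l , p , U

  no-detour : ∀ {m u v l} → Walk rot u v l → m ∉ l → u ≢ v → Adj rot m u → Adj rot v m → ⊥
  no-detour p m∉ u≢v mu vm with walk-toPath p
  ... | _ , [ _ ] , _ , _ = u≢v refl
  ... | _ , q@(_ ∷ q′) , U , q⊆ with walk-init q′
  ...   | ps , refl =
    acyclic (_ , _ ∷ ps , _ , ¬Any⇒All¬ _ (m∉ ∘ q⊆) AllPairs.∷ U , s≤s z≤n , mu ∷ walk-chain q , vm)

  no-common-detour : ∀ {l t₁ t₂ v L₁ L₂} → Adj rot l t₁ → Adj rot l t₂ → t₁ ≢ t₂ →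
    Walk rot v t₁ L₁ → l ∉ L₁ → Walk rot v t₂ L₂ → l ∉ L₂ → ⊥
  no-common-detour {L₁ = L₁} lt₁ lt₂ t₁≢t₂ p₁ l∉L₁ p₂ l∉L₂ with walk-++ (walk-reverse p₁) p₂
  ... | L , p , L⊆ = no-detour p l∉L t₁≢t₂ lt₁ (Adj-sym lt₂)
    where
    l∉L : _ ∉ L
    l∉L l∈ with ∈-++⁻ (reverse L₁) (L⊆ l∈)
    ... | inj₁ l∈L₁ = l∉L₁ (Any.reverse⁻ l∈L₁)
    ... | inj₂ l∈L₂ = l∉L₂ l∈L₂

  second∈walk : ∀ {a a′ b P W} → Adj rot a a′ → Walk rot a′ b P → Unique (a ∷ P) →
    Walk rot a b W → a′ ∈ W
  second∈walk _ [ _ ] _ q = walk-last q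
  second∈walk {a} {a′} {W = W} aa′ (a′a″ ∷ p) U q with a′ ∈? W
  ... | yes a′∈W = a′∈W
  ... | no a′∉W with walk-++ p (walk-reverse q)
  ...   | L , r , L⊆ = ⊥-elim (no-detour r a′∉L a″≢a a′a″ aa′)
    where
    a′∉L : a′ ∉ L
    a′∉L a′∈ with ∈-++⁻ _ (L⊆ a′∈)
    ... | inj₁ a′∈P = Unique-head (AllPairs.tail U) a′∈P
    ... | inj₂ a′∈W = a′∉W (Any.reverse⁻ a′∈W)
    a″≢a : _ ≢ a
    a″≢a refl = Unique-head U (there (walk-head p))

  path⊆walk : ∀ {a b P W} → Walk rot a b P → Unique P → Walk rot a b W → P ⊆ W
  path⊆walk [ _ ]   _ q (here refl) = walk-head q
  path⊆walk (_ ∷ _) _ q (here refl) = walk-head q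
  path⊆walk (a ∷ p) U q (there x∈) with path⊆walk p (AllPairs.tail U) (Adj-sym a ∷ q) x∈
  ... | here refl = second∈walk a p U q
  ... | there x∈W = x∈W

  pathFrom : V → V → List V
  pathFrom r u = proj₁ (path r u)

  pathFrom-walk : ∀ r u → Walk rot r u (pathFrom r u)
  pathFrom-walk r u = proj₁ (proj₂ (path r u))

  pathFrom-unique : ∀ r u → Unique (pathFrom r u)
  pathFrom-unique r u = proj₂ (proj₂ (path r u))

  Desc⇒∈pathFrom : ∀ {r v u} → Desc rot r v u → v ∈ pathFrom r u
  Desc⇒∈pathFrom {r} {u = u} (_ , (P , U) , v∈P) =
    path⊆walk (walk-fromWalkFromTo P) U (pathFrom-walk r u) v∈P

  ∈pathFrom⇒Desc : ∀ {r v u} → v ∈ pathFrom r u → Desc rot r v u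
  ∈pathFrom⇒Desc {r} {u = u} v∈ =
    pathFrom r u , (walk-toWalkFromTo (pathFrom-walk r u) , pathFrom-unique r u) , v∈

  Desc? : ∀ r v u → Dec (Desc rot r v u)
  Desc? r v u = map′ ∈pathFrom⇒Desc Desc⇒∈pathFrom (v ∈? pathFrom r u)

  Desc-refl : ∀ {r v} → Desc rot r v v
  Desc-refl {r} {v} = ∈pathFrom⇒Desc (walk-last (pathFrom-walk r v))

  Desc-trans : ∀ {r a b c} → Desc rot r a b → Desc rot r b c → Desc rot r a c
  Desc-trans {r} {a} {b} a≤b (P , (p , U) , b∈P) with walk-split (walk-fromWalkFromTo p) b∈P
  ... | pre , suf , refl , p₁ , _ =
    _ , (p , U) , ++⁺ʳ pre (λ { (here refl) → here refl })
                    (path⊆walk (pathFrom-walk r b) (pathFrom-unique r b) p₁ (Desc⇒∈pathFrom a≤b))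

  Desc-antisym : ∀ {r v w} → Desc rot r w v → Desc rot r v w → v ≡ w
  Desc-antisym {r} {v} {w} (P , (p , U) , w∈P) v≤w with walk-split (walk-fromWalkFromTo p) w∈P
  ... | pre , suf , refl , p₁ , p₂
    with ∈-++⁻ pre (path⊆walk (pathFrom-walk r w) (pathFrom-unique r w) p₁ (Desc⇒∈pathFrom v≤w))
  ...   | inj₂ (here v≡w) = v≡w
  ...   | inj₁ v∈pre      = ⊥-elim (Unique-disjoint pre U v∈pre (walk-last p₂))

  descendants : V → V → Subset n
  descendants r v = tabulate (λ u → ⌊ Desc? r v u ⌋)

  ∈-descendants : ∀ {r v u} → u ∈ₛ descendants r v ⇔ Desc rot r v u
  ∈-descendants {r} {v} {u} = ⇔-trans ∈-tabulate (mk⇔ (toWitness {a? = Desc? r v u}) fromWitness)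

  IsDescSet⇒≡descendants : ∀ {r v S} → IsDescSet rot r v S → S ≡ descendants r v
  IsDescSet⇒≡descendants S-desc = ⊆-antisym
    (λ {u} u∈S → Equivalence.from ∈-descendants (Equivalence.to (S-desc u) u∈S))
    (λ {u} u∈D → Equivalence.from (S-desc u) (Equivalence.to ∈-descendants u∈D))

  Desc-along-walk : ∀ {r l t v L} → Desc rot r l t → Walk rot v t L → l ∉ L → Desc rot r l v
  Desc-along-walk {r} {l} {v = v} (_ , (P , U) , l∈P) q l∉L with Desc? r l v
  ... | yes l≤v = l≤v
  ... | no l≰v with walk-++ (pathFrom-walk r v) q
  ...   | W , rt , W⊆ with ∈-++⁻ (pathFrom r v) (W⊆ (path⊆walk (walk-fromWalkFromTo P) U rt l∈P))
  ...     | inj₁ l∈path = ⊥-elim (l≰v (∈pathFrom⇒Desc l∈path))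
  ...     | inj₂ l∈L    = ⊥-elim (l∉L l∈L)

  Desc-∈-connected : ∀ {S r l v} → ConnectedSet rot S → r ∈ₛ S → v ∈ₛ S → Desc rot r l v → l ∈ₛ S
  Desc-∈-connected {r = r} {v = v} S-conn r∈S v∈S (_ , (P , U) , l∈P) with S-conn r v r∈S v∈S
  ... | _ , W , W⊆S = All.lookup W⊆S (path⊆walk (walk-fromWalkFromTo P) U (walk-fromWalkFromTo W) l∈P)

  module _ (c : Fin n → ℕ) (k g : ℕ) where

    wt-descendants-child : (∀ v → 1 ≤ c v) → ∀ {r v w} → Child rot r v w →
      wt c (descendants r w) < wt c (descendants r v)
    wt-descendants-child c-pos {v = v} (vw , v≤w) =
      wt-< c (λ u∈ → Equivalence.from ∈-descendants (Desc-trans v≤w (Equivalence.to ∈-descendants u∈)))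
        (Equivalence.from ∈-descendants Desc-refl) v∉ (c-pos v)
      where
      v∉ : v ∉ₛ _
      v∉ v∈ = rot-irrefl v (subst (_∈ rot v) (sym (Desc-antisym (Equivalence.to ∈-descendants v∈) v≤w)) vw)

    ancestor-of-support-∈ : ∀ {S r l} → ConnectedSet rot S → (∀ v → IsSupport rot c k g r v → v ∈ₛ S) →
      ∃[ v ] Desc rot r l v × LowestHeavy rot c k g r v → l ∈ₛ S
    ancestor-of-support-∈ {r = r} S-conn supports∈S (v , l≤v , lowest) =
      Desc-∈-connected S-conn (supports∈S r (inj₁ refl)) (supports∈S v (inj₂ lowest)) l≤v

    lowestHeavy-below : (∀ v → 1 ≤ c v) → ∀ {r v} → k < wt c (descendants r v) →
      ∃[ v′ ] Desc rot r v v′ × LowestHeavy rot c k g r v′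
    lowestHeavy-below c-pos {r} {v} = go v (<-wellFounded _)
      where
      heavy : ∀ {v} → k < wt c (descendants r v) → Heavy rot c k g r v
      heavy k< S S-desc = subst (λ S → k < wt c S) (sym (IsDescSet⇒≡descendants S-desc)) k<

      light : ∀ {v} → wt c (descendants r v) ≤ k → Light rot c k g r v
      light ≤k S S-desc = subst (λ S → wt c S ≤ k) (sym (IsDescSet⇒≡descendants S-desc)) ≤k

      go : ∀ v → Acc _<_ (wt c (descendants r v)) → k < wt c (descendants r v) →
        ∃[ v′ ] Desc rot r v v′ × LowestHeavy rot c k g r v′
      go v (acc rs) k< with any? (λ w → Desc? r v w ×-dec (k <? wt c (descendants r w))) (rot v)
      ... | yes heavy-child with find heavy-child
      ...   | w , vw , v≤w , k<w with go w (rs (wt-descendants-child c-pos (vw , v≤w))) k<w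
      ...     | v′ , w≤v′ , lowest = v′ , Desc-trans v≤w w≤v′ , lowest
      go v _ k< | no no-heavy-child =
        v , Desc-refl , heavy k< ,
        λ w (vw , v≤w) → light (≮⇒≥ (λ k<w → no-heavy-child (lose vw (v≤w , k<w))))

-- Iterating the Euler tour

_≟ᵈ_ : ∀ {n} → DecidableEquality (Fin n × Fin n)
_≟ᵈ_ = ≡-dec _≟ᶠ_ _≟ᶠ_

module _ {n : ℕ} (rot : Rot n) where

  private
    D = Dart rot
    succ = succ⁺ rot

  succ^ : D → ℕ → D
  succ^ x zero    = x
  succ^ x (suc i) = succ^ (succ x) i

  tour : D → ℕ → List D
  tour x zero    = x ∷ []
  tour x (suc h) = x ∷ tour (succ x) h

  FirstHit : D → D → ℕ → Set
  FirstHit x y h = succ^ x h ≡ y × (∀ i → i < h → succ^ x i ≢ y)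

  succ^-+ : ∀ x i j → succ^ x (i + j) ≡ succ^ (succ^ x i) j
  succ^-+ x zero    j = refl
  succ^-+ x (suc i) j = succ^-+ (succ x) i j

  succ^-suc : ∀ x i → succ^ x (suc i) ≡ succ (succ^ x i)
  succ^-suc x zero    = refl
  succ^-suc x (suc i) = succ^-suc (succ x) i

  ∈-tour⁻ : ∀ {d} x h → d ∈ tour x h → ∃[ i ] i ≤ h × d ≡ succ^ x i
  ∈-tour⁻ x zero    (here d≡x) = 0 , z≤n , d≡x
  ∈-tour⁻ x (suc h) (here d≡x) = 0 , z≤n , d≡x
  ∈-tour⁻ x (suc h) (there d∈) with ∈-tour⁻ (succ x) h d∈
  ... | i , i≤h , d≡ = suc i , s≤s i≤h , d≡

  ∈-tour⁺ : ∀ x {i h} → i ≤ h → succ^ x i ∈ tour x h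
  ∈-tour⁺ x {h = zero}  z≤n       = here refl
  ∈-tour⁺ x {h = suc h} z≤n       = here refl
  ∈-tour⁺ x             (s≤s i≤h) = there (∈-tour⁺ (succ x) i≤h)

  tour-mono : ∀ x {h h′} → h ≤ h′ → tour x h ⊆ tour x h′
  tour-mono x h≤h′ d∈ with ∈-tour⁻ x _ d∈
  ... | i , i≤h , refl = ∈-tour⁺ x (≤-trans i≤h h≤h′)

  tour-drop : ∀ x j e → tour (succ^ x j) e ⊆ tour x (j + e)
  tour-drop x j e d∈ with ∈-tour⁻ (succ^ x j) e d∈
  ... | i , i≤e , refl = subst (_∈ tour x (j + e)) (succ^-+ x j i) (∈-tour⁺ x (+-monoʳ-≤ j i≤e))

  tour-∷ʳ : ∀ x h → tour x (suc h) ≡ tour x h ∷ʳ succ^ x (suc h)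
  tour-∷ʳ x zero    = refl
  tour-∷ʳ x (suc h) = cong (x ∷_) (tour-∷ʳ (succ x) h)

  FirstHit-∷ : ∀ {x y h} → x ≢ y → FirstHit (succ x) y h → FirstHit x y (suc h)
  FirstHit-∷ x≢y (hit , miss) = hit , λ { zero _ → x≢y ; (suc i) (s≤s i<h) → miss i i<h }

  FirstHit-drop : ∀ {x y} j e → FirstHit x y (j + e) → FirstHit (succ^ x j) y e
  FirstHit-drop {x} j e (hit , miss) =
      trans (sym (succ^-+ x j e)) hit
    , λ i i<e → miss (j + i) (+-monoʳ-< j i<e) ∘ trans (succ^-+ x j i)

  private
    ==D-≡ : ∀ x → _==D_ rot x x ≡ true
    ==D-≡ (a , b) with a ≟ᶠ a | b ≟ᶠ b
    ... | yes _ | yes _ = refl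
    ... | no a≢a | _    = ⊥-elim (a≢a refl)
    ... | yes _ | no b≢b = ⊥-elim (b≢b refl)

    ==D-≢ : ∀ {x y} → x ≢ y → _==D_ rot x y ≡ false
    ==D-≢ {a , b} {c , d} x≢y with a ≟ᶠ c | b ≟ᶠ d
    ... | no _     | _        = refl
    ... | yes _    | no _     = refl
    ... | yes refl | yes refl = ⊥-elim (x≢y refl)

    pathFuel-≡ : ∀ f x → pathFuel rot (suc f) x x ≡ x ∷ []
    pathFuel-≡ f x rewrite ==D-≡ x = refl

    pathFuel-≢ : ∀ f {x y} → x ≢ y → pathFuel rot (suc f) x y ≡ x ∷ pathFuel rot f (succ x) y
    pathFuel-≢ f x≢y rewrite ==D-≢ x≢y = refl

    pathFuel-firstHit : ∀ {x y h} f → FirstHit x y h → h ≤ f → pathFuel rot f x y ≡ tour x h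
    pathFuel-firstHit           zero    (refl , _)    z≤n       = refl
    pathFuel-firstHit {x} {h = zero}  (suc f) (refl , _) _ = pathFuel-≡ f x
    pathFuel-firstHit {x} {h = suc h} (suc f) hit (s≤s h≤f) =
      trans (pathFuel-≢ f (proj₂ hit 0 (s≤s z≤n)))
            (cong (x ∷_) (pathFuel-firstHit f (FirstHit-drop 1 h hit) h≤f))

    pathFuel-tour : ∀ f x y → ∃[ h ] h ≤ f × pathFuel rot f x y ≡ tour x h
      × (∀ i → i < h → succ^ x i ≢ y) × (h < f → succ^ x h ≡ y)
    pathFuel-tour zero    x y = 0 , z≤n , refl , (λ _ ()) , λ ()
    pathFuel-tour (suc f) x y with x ≟ᵈ y
    ... | yes refl = 0 , z≤n , pathFuel-≡ f x , (λ _ ()) , λ _ → refl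
    ... | no x≢y with pathFuel-tour f (succ x) y
    ...   | h , h≤f , eq , miss , hit =
      suc h , s≤s h≤f , trans (pathFuel-≢ f x≢y) (cong (x ∷_) eq) , miss′ , λ { (s≤s h<f) → hit h<f }
      where
      miss′ : ∀ i → i < suc h → succ^ x i ≢ y
      miss′ zero    _         = x≢y
      miss′ (suc i) (s≤s i<h) = miss i i<h

  seg-firstHit : ∀ {x y h} → FirstHit x y h → h ≤ n * n → seg rot x y ≡ tour x h
  seg-firstHit = pathFuel-firstHit (n * n)

  seg-⊆-tour : ∀ {x y} i → succ^ x i ≡ y → seg rot x y ⊆ tour x i
  seg-⊆-tour {x} {y} i hit with pathFuel-tour (n * n) x y
  ... | h , _ , eq , miss , _ =
    subst (_⊆ tour x i) (sym eq) (tour-mono x (≮⇒≥ (λ i<h → miss i i<h hit)))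

  -- seg is computed with fuel n * n, and we never compare n * n with the length of C_T:
  -- an end that is not reached just makes the segment the longest one from x.
  seg-reached-or-maximal : ∀ x y → (∃[ h ] h < n * n × FirstHit x y h) ⊎ (∀ z → seg rot x z ⊆ seg rot x y)
  seg-reached-or-maximal x y with pathFuel-tour (n * n) x y
  ... | h , h≤F , eq , miss , hit with m≤n⇒m<n∨m≡n h≤F
  ...   | inj₁ h<F  = inj₁ (h , h<F , hit h<F , miss)
  ...   | inj₂ refl = inj₂ λ z d∈ → subst (_ ∈_) (sym eq) (seg-⊆-F z d∈)
    where
    seg-⊆-F : ∀ z → seg rot x z ⊆ tour x (n * n)
    seg-⊆-F z with pathFuel-tour (n * n) x z
    ... | h′ , h′≤F , eq′ , _ = subst (_⊆ tour x (n * n)) (sym eq′) (tour-mono x h′≤F)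

  seg-suffix-⊆ : ∀ {x y h i j} → FirstHit x y h → h ≤ n * n → i ≤ j → j ≤ h →
    seg rot (succ^ x j) y ⊆ seg rot (succ^ x i) y
  seg-suffix-⊆ {x} {y} {i = i} hit h≤F i≤j j≤h
    with a , refl ← m≤n⇒∃[o]m+o≡n i≤j | b , refl ← m≤n⇒∃[o]m+o≡n j≤h =
    subst (λ z → seg rot z y ⊆ seg rot (succ^ x i) y) (sym (succ^-+ x i a))
      (subst₂ _⊆_ (sym (seg-firstHit (FirstHit-drop a b hit-i) (≤-trans (m≤n+m b a) a+b≤F)))
                  (sym (seg-firstHit hit-i a+b≤F))
                  (tour-drop (succ^ x i) a b))
    where
    hit-i : FirstHit (succ^ x i) y (a + b)
    hit-i = FirstHit-drop i (a + b) (subst (FirstHit x y) (+-assoc i a b) hit)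
    a+b≤F : a + b ≤ n * n
    a+b≤F = ≤-trans (subst (a + b ≤_) (sym (+-assoc i a b)) (m≤n+m (a + b) i)) h≤F

module _ {n : ℕ} {rot : Rot n} (PT : IsPlaneTree rot) where

  open IsPlaneTree PT

  private
    succ = succ⁺ rot
    pred = pred⁻ rot

  succ-isDart : ∀ {d} → IsDart rot d → IsDart rot (succ d)
  succ-isDart {u , v} uv = after-∈ rot (rot-unique v) (rot-sym u v uv)

  pred-isDart : ∀ {d} → IsDart rot d → IsDart rot (pred d)
  pred-isDart {v , w} vw = rot-sym v _ (before-∈ rot (rot-unique v) vw)

  succ-pred : ∀ {d} → IsDart rot d → succ (pred d) ≡ d
  succ-pred {v , w} vw = cong (v ,_) (after-before rot (rot-unique v) vw)

  pred-succ : ∀ {d} → IsDart rot d → pred (succ d) ≡ d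
  pred-succ {u , v} uv = cong (_, v) (before-after rot (rot-unique v) (rot-sym u v uv))

  pred-injective : ∀ {d e} → IsDart rot d → IsDart rot e → pred d ≡ pred e → d ≡ e
  pred-injective {d} {e} d-dart e-dart eq = begin
    d               ≡⟨ sym (succ-pred d-dart) ⟩
    succ (pred d)   ≡⟨ cong succ eq ⟩
    succ (pred e)   ≡⟨ succ-pred e-dart ⟩
    e               ∎
    where open ≡-Reasoning

  succ^-isDart : ∀ {x} → IsDart rot x → ∀ i → IsDart rot (succ^ rot x i)
  succ^-isDart x-dart zero    = x-dart
  succ^-isDart x-dart (suc i) = succ^-isDart (succ-isDart x-dart) i

  succ^-injective : ∀ {x y} → IsDart rot x → IsDart rot y → ∀ i → succ^ rot x i ≡ succ^ rot y i → x ≡ y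
  succ^-injective x-dart y-dart zero    eq = eq
  succ^-injective x-dart y-dart (suc i) eq = begin
    _                ≡⟨ sym (pred-succ x-dart) ⟩
    pred (succ _)    ≡⟨ cong pred (succ^-injective (succ-isDart x-dart) (succ-isDart y-dart) i eq) ⟩
    pred (succ _)    ≡⟨ pred-succ y-dart ⟩
    _                ∎
    where open ≡-Reasoning

  tour-walk : ∀ {x} → IsDart rot x → ∀ h →
    Walk rot (ρ rot x) (ρ rot (succ^ rot x h)) (map (ρ rot) (tour rot x h))
  tour-walk x-dart zero    = [ _ ]
  tour-walk x-dart (suc h) = x-dart ∷ tour-walk (succ-isDart x-dart) h

  seg-pred-⊆ : ∀ {x t h} → IsDart rot x → FirstHit rot x t h → h < n * n →
    seg rot (pred x) t ⊆ pred x ∷ tour rot x h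
  seg-pred-⊆ {x} {t} {h} x-dart hit h<F with pred x ≟ᵈ t
  ... | yes refl =
    subst (_⊆ pred x ∷ tour rot x h) (sym (seg-firstHit rot {h = 0} (refl , λ _ ()) z≤n))
      λ { (here refl) → here refl }
  ... | no px≢t = ⊆-reflexive
    (trans (seg-firstHit rot hit′ h<F) (cong (λ z → pred x ∷ tour rot z h) (succ-pred x-dart)))
    where
    hit′ : FirstHit rot (pred x) t (suc h)
    hit′ = FirstHit-∷ rot px≢t (subst (λ z → FirstHit rot z t h) (sym (succ-pred x-dart)) hit)

module _ {n : ℕ} (rot : Rot n) where

  ∈-segV : ∀ {v x y} → v ∈ₛ segV rot x y ⇔ v ∈ map (ρ rot) (seg rot x y)
  ∈-segV {v} {x} {y} = ⇔-trans ∈-tabulate (mk⇔ (visits (seg rot x y)) (visited (seg rot x y)))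
    where
    visits : ∀ ds → T (any (λ z → _==_ rot (ρ rot z) v) ds) → v ∈ map (ρ rot) ds
    visits (d ∷ ds) t with ρ rot d ≟ᶠ v
    ... | yes refl = here refl
    ... | no _     = there (visits ds t)
    visited : ∀ ds → v ∈ map (ρ rot) ds → T (any (λ z → _==_ rot (ρ rot z) v) ds)
    visited (d ∷ ds) v∈ with ρ rot d ≟ᶠ v
    ... | yes _ = tt
    ... | no ρd≢v with v∈
    ...   | here v≡ρd = ⊥-elim (ρd≢v (sym v≡ρd))
    ...   | there v∈′ = visited ds v∈′

  wt-segV-mono : ∀ (c : Fin n → ℕ) {x y x′ y′} →
    map (ρ rot) (seg rot x y) ⊆ map (ρ rot) (seg rot x′ y′) → wt c (segV rot x y) ≤ wt c (segV rot x′ y′)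
  wt-segV-mono c ⊆ = wt-mono c (λ v∈ → Equivalence.from ∈-segV (⊆ (Equivalence.to ∈-segV v∈)))

-- Maximal overload-discharge quadruples

module _ {n : ℕ} {rot : Rot n} (PT : IsPlaneTree rot) where

  private
    D = Dart rot
    succ = succ⁺ rot
    pred = pred⁻ rot

  record FreshArrival (x y : D) : Set where
    field
      len       : ℕ
      len<F     : len < n * n
      hits-pred : FirstHit rot x (pred y) len
      seg-pred  : seg rot x (pred y) ≡ tour rot x len
      hits      : FirstHit rot x y (suc len)
      seg-end   : seg rot x y ≡ tour rot x len ∷ʳ y
      end-fresh : ρ rot y ∉ map (ρ rot) (tour rot x len)

  freshArrival : ∀ (c : Fin n → ℕ) {x y} → IsDart rot y →
    wt c (segV rot x (pred y)) < wt c (segV rot x y) → FreshArrival x y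
  freshArrival c {x} {y} y-dart lighter with seg-reached-or-maximal rot x (pred y)
  ... | inj₂ maximal = ⊥-elim (<⇒≱ lighter (wt-segV-mono rot c (map⁺ (ρ rot) (maximal y))))
  ... | inj₁ (h , h<F , hit-t) = record
    { len = h ; len<F = h<F ; hits-pred = hit-t ; seg-pred = seg-t
    ; hits = hit-y ; seg-end = seg-y ; end-fresh = end-fresh }
    where
    ⊈ : ¬ (map (ρ rot) (seg rot x y) ⊆ map (ρ rot) (seg rot x (pred y)))
    ⊈ = <⇒≱ lighter ∘ wt-segV-mono rot c
    seg-t : seg rot x (pred y) ≡ tour rot x h
    seg-t = seg-firstHit rot hit-t (<⇒≤ h<F)
    reach-y : succ^ rot x (suc h) ≡ y
    reach-y = trans (succ^-suc rot x h) (trans (cong succ (proj₁ hit-t)) (succ-pred PT y-dart))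
    hit-y : FirstHit rot x y (suc h)
    hit-y = reach-y , λ i i≤h i-hit → ⊈ (map⁺ (ρ rot)
      (subst (seg rot x y ⊆_) (sym seg-t) (tour-mono rot x (≤-pred i≤h) ∘ seg-⊆-tour rot i i-hit)))
    seg-y : seg rot x y ≡ tour rot x h ∷ʳ y
    seg-y = trans (seg-firstHit rot hit-y h<F) (trans (tour-∷ʳ rot x h) (cong (tour rot x h ∷ʳ_) reach-y))
    end-fresh : ρ rot y ∉ map (ρ rot) (tour rot x h)
    end-fresh ρy∈ = ⊈ (subst (λ s → _ ⊆ map (ρ rot) s) (sym seg-t) seg⊆tour)
      where
      seg⊆tour : map (ρ rot) (seg rot x y) ⊆ map (ρ rot) (tour rot x h)
      seg⊆tour v∈ with d , d∈ , refl ← ∈-map⁻ (ρ rot) v∈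
        with ∈-++⁻ (tour rot x h) (subst (d ∈_) seg-y d∈)
      ... | inj₁ d∈tour      = ∈-map⁺ (ρ rot) d∈tour
      ... | inj₂ (here refl) = ρy∈

  open FreshArrival

  longer-arrival⇒seg-⊆ : ∀ {x₁ x₂ y} → IsDart rot x₁ → IsDart rot x₂ →
    (a₁ : FreshArrival x₁ y) (a₂ : FreshArrival x₂ y) → len a₁ < len a₂ →
    seg rot (pred x₁) (pred y) ⊆ seg rot x₂ (pred y)
  longer-arrival⇒seg-⊆ {x₁} {x₂} {y} x₁-dart x₂-dart a₁ a₂ len₁<len₂
    with o , 1+len₁+o≡len₂ ← m≤n⇒∃[o]m+o≡n len₁<len₂ =
    subst (λ z → seg rot z (pred y) ⊆ seg rot x₂ (pred y)) (sym pred-x₁)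
      (seg-suffix-⊆ rot (hits-pred a₂) (<⇒≤ (len<F a₂)) z≤n o≤len₂)
    where
    open ≡-Reasoning
    o+1+len₁≡len₂ : o + suc (len a₁) ≡ len a₂
    o+1+len₁≡len₂ = trans (+-comm o (suc (len a₁))) 1+len₁+o≡len₂
    o≤len₂ : o ≤ len a₂
    o≤len₂ = subst (o ≤_) o+1+len₁≡len₂ (m≤m+n o _)
    succ-o : succ (succ^ rot x₂ o) ≡ x₁
    succ-o = succ^-injective PT (succ-isDart PT (succ^-isDart PT x₂-dart o)) x₁-dart (len a₁) (begin
      succ^ rot (succ^ rot x₂ o) (suc (len a₁)) ≡⟨ sym (succ^-+ rot x₂ o (suc (len a₁))) ⟩
      succ^ rot x₂ (o + suc (len a₁)) ≡⟨ cong (succ^ rot x₂) o+1+len₁≡len₂ ⟩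
      succ^ rot x₂ (len a₂)           ≡⟨ proj₁ (hits-pred a₂) ⟩
      pred y                          ≡⟨ sym (proj₁ (hits-pred a₁)) ⟩
      succ^ rot x₁ (len a₁)           ∎)
    pred-x₁ : pred x₁ ≡ succ^ rot x₂ o
    pred-x₁ = trans (cong pred (sym succ-o)) (pred-succ PT (succ^-isDart PT x₂-dart o))

  earlier-w⇒seg-⊆ : ∀ {x y i j} (a : FreshArrival x y) → i < j → j ≤ suc (len a) →
    seg rot (succ^ rot x j) y ⊆ seg rot (succ (succ^ rot x i)) y
  earlier-w⇒seg-⊆ {x} {y} {i} {j} a i<j j≤ =
    subst (λ z → seg rot (succ^ rot x j) y ⊆ seg rot z y) (succ^-suc rot x i)
      (seg-suffix-⊆ rot (hits a) (len<F a) i<j j≤)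

  detour : ∀ {x y v} → IsDart rot x → (a : FreshArrival x y) → v ∈ map (ρ rot) (tour rot x (len a)) →
    ∃[ L ] Walk rot v (ρ rot (pred y)) L × ρ rot y ∉ L
  detour x-dart a v∈ with walk-split (tour-walk PT x-dart (len a)) v∈
  ... | pre , suf , eq , _ , p =
      _ , subst (λ z → Walk rot _ (ρ rot z) _) (proj₁ (hits-pred a)) p
    , λ ρy∈ → end-fresh a (subst (_ ∈_) (sym eq) (∈-++⁺ʳ pre ρy∈))

  detour-from-segV : ∀ {x y v} → IsDart rot x → FreshArrival x y → v ∈ₛ segV rot x y → v ≢ ρ rot y →
    ∃[ L ] Walk rot v (ρ rot (pred y)) L × ρ rot y ∉ L
  detour-from-segV {x} {y} x-dart a v∈ v≢ρy
    with d , d∈ , refl ← ∈-map⁻ (ρ rot) (Equivalence.to (∈-segV rot) v∈)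
    with ∈-++⁻ (tour rot x (len a)) (subst (d ∈_) (seg-end a) d∈)
  ... | inj₁ d∈tour    = detour x-dart a (∈-map⁺ (ρ rot) d∈tour)
  ... | inj₂ (here refl) = ⊥-elim (v≢ρy refl)

  end-∈-segV : ∀ {x y} → FreshArrival x y → ρ rot y ∈ₛ segV rot x y
  end-∈-segV {x} {y} a = Equivalence.from (∈-segV rot)
    (∈-map⁺ (ρ rot) (subst (y ∈_) (sym (seg-end a)) (∈-++⁺ʳ (tour rot x (len a)) (here refl))))

  tail-adj : ∀ {y} → IsDart rot y → Adj rot (ρ rot y) (ρ rot (pred y))
  tail-adj y-dart = Adj-sym PT (pred-isDart PT y-dart)

  module _ (c : Fin n → ℕ) (k g : ℕ) where

    private
      QData = QuadData rot c k g
      MaxQuad = MaxQuadData rot c k g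
      Q = quad rot c k g

      heavy≰light : ∀ {a b} → k < a → b + g ≤ k → ¬ (a ≤ b)
      heavy≰light k<a b+g≤k a≤b = <⇒≱ k<a (≤-trans a≤b (≤-trans (m≤m+n _ g) b+g≤k))

    QuadData⇒FreshArrival : ∀ {x y w} → QData x y w → FreshArrival x y
    QuadData⇒FreshArrival (_ , y-dart , _ , light , heavy , _) =
      freshArrival c y-dart (≤-<-trans (≤-trans (m≤m+n _ g) light) heavy)

    private
      arrival : ∀ {x y w} → MaxQuad x y w → FreshArrival x y
      arrival = QuadData⇒FreshArrival ∘ proj₁

      -- If y⁻ is reached later from x₂, then x₁⁻ lies on [x₂, y⁻], so the heavy segment
      -- [x₁⁻, y⁻] sits inside the light segment [x₂, y⁻].
      ¬longer : ∀ {x₁ x₂ y w₁ w₂} (q₁ : MaxQuad x₁ y w₁) (q₂ : MaxQuad x₂ y w₂) →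
        ¬ (len (arrival q₁) < len (arrival q₂))
      ¬longer q₁@((x₁-dart , _) , overloaded₁) q₂@((x₂-dart , _ , _ , light₂ , _) , _) longer =
        heavy≰light overloaded₁ light₂ (wt-segV-mono rot c (map⁺ (ρ rot)
          (longer-arrival⇒seg-⊆ x₁-dart x₂-dart (arrival q₁) (arrival q₂) longer)))

      ¬earlier : ∀ {x y w₁ w₂ i j} (a : FreshArrival x y) → QData x y w₁ → QData x y w₂ →
        w₁ ≡ succ^ rot x i → w₂ ≡ succ^ rot x j → i < j → j ≤ len a → ⊥
      ¬earlier a (_ , _ , _ , _ , _ , _ , _ , light₁) (_ , _ , _ , _ , _ , _ , heavy₂ , _) refl refl i<j j≤len =
        heavy≰light heavy₂ light₁
          (wt-segV-mono rot c (map⁺ (ρ rot) (earlier-w⇒seg-⊆ a i<j (m≤n⇒m≤1+n j≤len))))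

      w-position : ∀ {x y w} (a : FreshArrival x y) → QData x y w →
        ∃[ i ] i ≤ len a × w ≡ succ^ rot x i
      w-position {x} a (_ , _ , _ , _ , _ , w∈ , _) = ∈-tour⁻ rot x (len a) (subst (_ ∈_) (seg-pred a) w∈)

      w-unique-along : ∀ {x y w₁ w₂} (a : FreshArrival x y) →
        QData x y w₁ → QData x y w₂ → w₁ ≡ w₂
      w-unique-along {x} a d₁ d₂ with w-position a d₁ | w-position a d₂
      ... | i , i≤len , w₁≡ | j , j≤len , w₂≡ with <-cmp i j
      ...   | tri< i<j _ _ = ⊥-elim (¬earlier a d₁ d₂ w₁≡ w₂≡ i<j j≤len)
      ...   | tri> _ _ j<i = ⊥-elim (¬earlier a d₂ d₁ w₂≡ w₁≡ j<i i≤len)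
      ...   | tri≈ _ i≡j _ = trans w₁≡ (trans (cong (succ^ rot x) i≡j) (sym w₂≡))

    start-unique : ∀ {x₁ x₂ y w₁ w₂} → MaxQuad x₁ y w₁ → MaxQuad x₂ y w₂ → x₁ ≡ x₂
    start-unique {x₂ = x₂} {y} q₁ q₂ with <-cmp (len (arrival q₁)) (len (arrival q₂))
    ... | tri< longer _ _ = ⊥-elim (¬longer q₁ q₂ longer)
    ... | tri> _ _ longer = ⊥-elim (¬longer q₂ q₁ longer)
    ... | tri≈ _ same _   = succ^-injective PT (proj₁ (proj₁ q₁)) (proj₁ (proj₁ q₂)) (len (arrival q₁))
      (trans (proj₁ (hits-pred (arrival q₁)))
        (sym (subst (λ m → succ^ rot x₂ m ≡ pred y) (sym same) (proj₁ (hits-pred (arrival q₂))))))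

    w-unique : ∀ {x y w₁ w₂} → QData x y w₁ → QData x y w₂ → w₁ ≡ w₂
    w-unique d₁ = w-unique-along (QuadData⇒FreshArrival d₁) d₁

    end-determines-quad : ∀ {x₁ x₂ y w₁ w₂} → MaxQuad x₁ y w₁ → MaxQuad x₂ y w₂ →
      Q x₁ y w₁ ≡ Q x₂ y w₂
    end-determines-quad q₁ q₂
      with refl ← start-unique q₁ q₂
      with refl ← w-unique (proj₁ q₁) (proj₁ q₂) = refl

    distinct-tails : ∀ {x₁ x₂ y₁ y₂ w₁ w₂} → MaxQuad x₁ y₁ w₁ → MaxQuad x₂ y₂ w₂ →
      Q x₁ y₁ w₁ ≢ Q x₂ y₂ w₂ → ρ rot y₁ ≡ ρ rot y₂ → ρ rot (pred y₁) ≢ ρ rot (pred y₂)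
    distinct-tails q₁@((_ , y₁-dart , _) , _) q₂@((_ , y₂-dart , _) , _) q₁≢q₂ ρy≡ ρt≡
      with refl ← pred-injective PT y₁-dart y₂-dart (cong₂ _,_ ρt≡ ρy≡) = q₁≢q₂ (end-determines-quad q₁ q₂)

    segV-∩ : ∀ {x₁ x₂ y₁ y₂ w₁ w₂} → MaxQuad x₁ y₁ w₁ → MaxQuad x₂ y₂ w₂ →
      Q x₁ y₁ w₁ ≢ Q x₂ y₂ w₂ → ρ rot y₁ ≡ ρ rot y₂ →
      segV rot x₁ y₁ ∩ segV rot x₂ y₂ ≡ ⁅ ρ rot y₁ ⁆
    segV-∩ {x₁} {x₂} {y₁ = l , _} {y₂ = _ , _}
      q₁@((x₁-dart , y₁-dart , _) , _) q₂@((x₂-dart , y₂-dart , _) , _) q₁≢q₂ refl =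
      ⊆-antisym ∩⊆⁅l⁆ ⁅l⁆⊆∩
      where
      ∩⊆⁅l⁆ : segV rot x₁ _ ∩ segV rot x₂ _ ⊆ₛ ⁅ l ⁆
      ∩⊆⁅l⁆ {v} v∈ with v ≟ᶠ l
      ... | yes refl = x∈⁅x⁆ v
      ... | no v≢l
        with _ , p₁ , l∉₁ ← detour-from-segV x₁-dart (arrival q₁) (p∩q⊆p _ _ v∈) v≢l
           | _ , p₂ , l∉₂ ← detour-from-segV x₂-dart (arrival q₂) (p∩q⊆q _ _ v∈) v≢l
        = ⊥-elim (no-common-detour PT (tail-adj y₁-dart) (tail-adj y₂-dart)
                   (distinct-tails q₁ q₂ q₁≢q₂ refl) p₁ l∉₁ p₂ l∉₂)
      ⁅l⁆⊆∩ : ⁅ l ⁆ ⊆ₛ segV rot x₁ _ ∩ segV rot x₂ _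
      ⁅l⁆⊆∩ v∈ with refl ← x∈⁅y⁆⇒x≡y l v∈ = x∈p∩q⁺ (end-∈-segV (arrival q₁) , end-∈-segV (arrival q₂))

    -- If l is on the r–t path, every vertex of [x⁻, y⁻] hangs below l, so T^{(r)}_l is heavy.
    toward-root : (∀ v → 1 ≤ c v) → ∀ r {x y w} → MaxQuad x y w →
        (∃[ L ] Walk rot r (ρ rot (pred y)) L × ρ rot y ∉ L)
      ⊎ (∃[ v ] Desc rot r (ρ rot y) v × LowestHeavy rot c k g r v)
    toward-root c-pos r {x} {y} q@((x-dart , _) , overloaded) with Desc? PT r (ρ rot y) (ρ rot (pred y))
    ... | no l≰t  = inj₁ (pathFrom PT r _ , pathFrom-walk PT r _ , l≰t ∘ ∈pathFrom⇒Desc PT)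
    ... | yes l≤t =
      inj₂ (lowestHeavy-below PT c k g c-pos (<-≤-trans overloaded (wt-mono c segV⊆descendants)))
      where
      a = arrival q
      l = ρ rot y

      tour-below : ∀ {v} → v ∈ map (ρ rot) (tour rot x (len a)) → Desc rot r l v
      tour-below v∈ with _ , p , l∉ ← detour x-dart a v∈ = Desc-along-walk PT l≤t p l∉

      pred-below : Desc rot r l (ρ rot (pred x))
      pred-below with ρ rot (pred x) ≟ᶠ l
      ... | yes refl = Desc-refl PT
      ... | no ≢l with _ , p , l∉ ← detour x-dart a (∈-map⁺ (ρ rot) (∈-tour⁺ rot x z≤n)) =
        Desc-along-walk PT l≤t (pred-isDart PT x-dart ∷ p) λ { (here refl) → ≢l refl ; (there l∈) → l∉ l∈ }

      segV⊆descendants : segV rot (pred x) (pred y) ⊆ₛ descendants PT r l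
      segV⊆descendants v∈ with d , d∈ , refl ← ∈-map⁻ (ρ rot) (Equivalence.to (∈-segV rot) v∈)
        with seg-pred-⊆ PT x-dart (hits-pred a) (len<F a) d∈
      ... | here refl = Equivalence.from (∈-descendants PT) pred-below
      ... | there d∈′ = Equivalence.from (∈-descendants PT) (tour-below (∈-map⁺ (ρ rot) d∈′))

    ∈-supportTree : (∀ v → 1 ≤ c v) → ∀ r {x₁ x₂ y₁ y₂ w₁ w₂} →
      MaxQuad x₁ y₁ w₁ → MaxQuad x₂ y₂ w₂ →
      Q x₁ y₁ w₁ ≢ Q x₂ y₂ w₂ → ρ rot y₁ ≡ ρ rot y₂ →
      InSupportTree rot c k g r (ρ rot y₁)
    ∈-supportTree c-pos r {y₁ = _ , _} {y₂ = _ , _} q₁@((_ , y₁-dart , _) , _) q₂@((_ , y₂-dart , _) , _)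
      q₁≢q₂ refl S S-conn supports∈S
      with toward-root c-pos r q₁ | toward-root c-pos r q₂
    ... | inj₁ (_ , p₁ , l∉₁) | inj₁ (_ , p₂ , l∉₂) =
      ⊥-elim (no-common-detour PT (tail-adj y₁-dart) (tail-adj y₂-dart)
                (distinct-tails q₁ q₂ q₁≢q₂ refl) p₁ l∉₁ p₂ l∉₂)
    ... | inj₂ below | _          = ancestor-of-support-∈ PT c k g S-conn supports∈S below
    ... | _          | inj₂ below = ancestor-of-support-∈ PT c k g S-conn supports∈S below

lemma5 : (n : ℕ) (rot : Rot n) → IsPlaneTree rot →
    (c : Fin n → ℕ) → (∀ v → 1 ≤ c v) →
    (k g : ℕ) → 1 ≤ k → k ≤ wt c ⊤ → (∀ v → c v ≤ k) → 1 ≤ g →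
    Omega rot c k g →
    (a r : Fin n) → LowestHeavy rot c k g a r →
    (x₁ y₁ w₁ x₂ y₂ w₂ : Dart rot) →
    MaxQuadData rot c k g x₁ y₁ w₁ → MaxQuadData rot c k g x₂ y₂ w₂ →
    quad rot c k g x₁ y₁ w₁ ≢ quad rot c k g x₂ y₂ w₂ →
    ρ rot y₁ ≡ ρ rot y₂ →
    (segV rot x₁ y₁ ∩ segV rot x₂ y₂ ≡ ⁅ ρ rot y₁ ⁆)
      × InSupportTree rot c k g r (ρ rot y₁)
lemma5 n rot PT c c-pos k g _ _ _ _ _ _ r _ _ _ _ _ _ _ q₁ q₂ q₁≢q₂ ρy≡ =
  segV-∩ PT c k g q₁ q₂ q₁≢q₂ ρy≡ , ∈-supportTree PT c k g c-pos r q₁ q₂ q₁≢q₂ ρy≡
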